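{- Let $b,n\in\mathbb{N}$, let $\mathcal{L}$ be a layering of an $n$-vertex graph $G$, and let $S\subseteq V(G)$ be such that $|L\cap S|\le b$ for each $L\in\mathcal{L}$. Then for any real $d>0$ there exists $X\subseteq V(G)$ with $|X|\le bn/d$ such that each connected component of $G-X$ contains at most $d$ vertices of $S$.
   Context: A layering of a graph $G$ is a sequence $(L_0,\dots,L_m)$ of pairwise disjoint (possibly empty) subsets of $V(G)$ with union $V(G)$ such that $N_G[L_i]\subseteq L_{i-1}\cup L_i\cup L_{i+1}$ for each $i$ (with $L_{ -1}=L_{m+1}=\emptyset$).
   Formalization: The parameter d ranges over the positive rationals instead of the positive reals. -}

module Defs where

open import Data.Nat using (ℕ; suc; _≤_)
open import Data.Nat.Properties using ()
open import Data.Bool using (Bool; true; false)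
open import Data.Fin using (Fin; toℕ)
open import Data.Fin.Subset using (Subset; _∈_; _∉_; _∩_; _⊆_; ∣_∣; ⊥)
open import Data.Product using (Σ; ∃; _×_; _,_)
open import Relation.Binary.PropositionalEquality using (_≡_)
open import Relation.Nullary using (¬_)
open import Data.Integer using (+_)
import Data.Rational as ℚ
open ℚ using (ℚ)

record Graph (n : ℕ) : Set where
  field
    adj    : Fin n → Fin n → Bool
    sym    : ∀ u v → adj u v ≡ adj v u
    irrefl : ∀ v → adj v v ≡ false
open Graph public

Adj : ∀ {n} → Graph n → Fin n → Fin n → Set
Adj G u v = adj G u v ≡ true

-- A layering (L_0, ..., L_m) of G: m+1 pairwise disjoint subsets of V(G)
-- covering V(G), such that N_G[L_i] ⊆ L_{i-1} ∪ L_i ∪ L_{i+1}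
-- (with L_{-1} = L_{m+1} = ∅).
record Layering {n : ℕ} (G : Graph n) : Set where
  field
    m        : ℕ
    L        : Fin (suc m) → Subset n
    disjoint : ∀ i j → ¬ (i ≡ j) → L i ∩ L j ≡ ⊥
    cover    : ∀ v → ∃ λ i → v ∈ L i
    -- closed neighbourhood condition: vertices of L_i are in L_{i-1} ∪ L_i ∪ L_{i+1}
    -- trivially; a neighbour w of v ∈ L_i lies in some L_j with |i - j| ≤ 1.
    nbhd     : ∀ i v w → v ∈ L i → Adj G v w →
               ∃ λ j → w ∈ L j × toℕ j ≤ suc (toℕ i) × toℕ i ≤ suc (toℕ j)
open Layering public

data Reach {n : ℕ} (G : Graph n) (X : Subset n) (u : Fin n) : Fin n → Set where
  here : u ∉ X → Reach G X u u
  step : ∀ {v w} → Reach G X u v → Adj G v w → w ∉ X → Reach G X u w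

ℕtoℚ : ℕ → ℚ
ℕtoℚ k = (+ k) ℚ./ 1

-- Let depth(v) be the index of the layer containing v, so adjacent vertices have depths differing
-- by at most one.  For k ≥ 1 and a shift t < k, deleting X_t = {v : k ∣ depth(v) + t} confines
-- every component of G − X_t to k − 1 consecutive layers, so it meets S in at most (k − 1)b
-- vertices.  The k sets X_t partition V(G), hence one of them has at most n/k vertices.  Writing
-- d = p/q, the block length k = ⌊d/b⌋ + 1 gives (k − 1)b ≤ d and n/k ≤ bn/d.
module Submission where

open import Defs hiding (sym)
open import Data.Nat
open import Data.Nat.Properties
open import Algebra.Properties.CommutativeMonoid.Sum +-0-commutativeMonoid
  using (sum; sum-syntax; ∑-comm; sum-cong-≗; sum-replicate-zero)
open import Data.Bool using (Bool; true; false)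
open import Data.Empty using (⊥-elim; ⊥-elim-irr)
open import Data.Fin as Fin using (Fin; zero; suc; toℕ)
open import Data.Fin.Properties using (toℕ-fromℕ<; toℕ-injective; toℕ<n)
open import Data.Fin.Subset using (Subset; _∈_; _∉_; _∩_; _⊆_; ∣_∣; Empty)
open import Data.Fin.Subset.Properties
  using (x∈p∩q⁺; x∈p∩q⁻; p⊆q⇒∣p∣≤∣q∣; nonempty?; Empty-unique; ∣⊥∣≡0; ∉⊥)
import Data.Integer as ℤ
import Data.Integer.Properties as ℤ
open import Data.Nat.Coprimality using (Coprime)
open import Data.Nat.DivMod using (m≡m%n+[m/n]*n; m%n<n; m/n*n≤m)
open import Data.Nat.Divisibility using (_∣_; _∤_; _∣?_; n∣m*n; m%n≡0⇒n∣m; ∣m+n∣m⇒∣n; >⇒∤)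
open import Data.Product using (Σ; ∃; _×_; _,_; proj₁; proj₂)
import Data.Rational as ℚ
open import Data.Rational using (ℚ; Positive)
open import Data.Rational.Properties using (pos⇒nonZero; toℚᵘ-cancel-≤; toℚᵘ-fromℚᵘ; toℚᵘ-homo-*)
import Data.Rational.Unnormalised as ℚᵘ
import Data.Rational.Unnormalised.Properties as ℚᵘ
open import Data.Vec using ([]; _∷_; lookup; tabulate)
open import Data.Vec.Properties using (lookup∘tabulate; []=⇒lookup; lookup⇒[]=)
open import Function using (_∘_)
open import Relation.Binary.PropositionalEquality
open import Relation.Nullary using (¬_; Dec; yes; no; does)
open import Relation.Nullary.Decidable using (dec-true; dec-false)
open import Relation.Unary using (Pred; Decidable)

sum-mono-≤ : ∀ {k} {f g : Fin k → ℕ} → (∀ i → f i ≤ g i) → sum f ≤ sum g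
sum-mono-≤ {zero}  f≤g = z≤n
sum-mono-≤ {suc k} f≤g = +-mono-≤ (f≤g zero) (sum-mono-≤ (f≤g ∘ suc))

≤-sum : ∀ {k} (f : Fin k → ℕ) i → f i ≤ sum f
≤-sum f zero    = m≤m+n (f zero) _
≤-sum f (suc i) = ≤-trans (≤-sum (f ∘ suc) i) (m≤n+m _ (f zero))

∑-const : ∀ k c → ∑[ i < k ] c ≡ k * c
∑-const zero    c = refl
∑-const (suc k) c = cong (c +_) (∑-const k c)

∃-*≤sum : ∀ {k} (f : Fin (suc k) → ℕ) → ∃ λ i → suc k * f i ≤ sum f
∃-*≤sum {zero}  f = zero , ≤-refl
∃-*≤sum {suc k} f with ∃-*≤sum (f ∘ suc)
... | i , [1+k]fi≤∑ with f zero ≤? f (suc i)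
...   | yes f0≤fi = zero , +-monoʳ-≤ (f zero) (≤-trans (*-monoʳ-≤ (suc k) f0≤fi) [1+k]fi≤∑)
...   | no  f0≰fi = suc i , +-mono-≤ (<⇒≤ (≰⇒> f0≰fi)) [1+k]fi≤∑

𝟙 : Bool → ℕ
𝟙 true  = 1
𝟙 false = 0

sum-𝟙-≤1 : ∀ {k p} {P : Pred (Fin k) p} (P? : Decidable P) →
           (∀ {i j} → i Fin.< j → P i → ¬ P j) → ∑[ i < k ] 𝟙 (does (P? i)) ≤ 1
sum-𝟙-≤1 {zero}  P? atMostOne = z≤n
sum-𝟙-≤1 {suc k} P? atMostOne with P? zero
... | no  _  = sum-𝟙-≤1 (P? ∘ suc) (atMostOne ∘ s<s)
... | yes P0 = ≤-reflexive (cong suc (trans (sum-cong-≗ rest≡0) (sum-replicate-zero k)))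
  where
  rest≡0 : ∀ j → 𝟙 (does (P? (suc j))) ≡ 0
  rest≡0 j = cong 𝟙 (dec-false (P? (suc j)) (atMostOne z<s P0))

∣p∣≡∑𝟙 : ∀ {n} (p : Subset n) → ∣ p ∣ ≡ ∑[ i < n ] 𝟙 (lookup p i)
∣p∣≡∑𝟙 []          = refl
∣p∣≡∑𝟙 (true  ∷ p) = cong suc (∣p∣≡∑𝟙 p)
∣p∣≡∑𝟙 (false ∷ p) = ∣p∣≡∑𝟙 p

Empty⇒∣p∣≡0 : ∀ {n} {p : Subset n} → Empty p → ∣ p ∣ ≡ 0
Empty⇒∣p∣≡0 {n} empty = trans (cong ∣_∣ (Empty-unique empty)) (∣⊥∣≡0 n)

module _ {n p} {P : Pred (Fin n) p} where

  subset : Decidable P → Subset n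
  subset P? = tabulate (does ∘ P?)

  ∈-subset⁺ : (P? : Decidable P) → ∀ {i} → P i → i ∈ subset P?
  ∈-subset⁺ P? {i} Pi = lookup⇒[]= i _ (trans (lookup∘tabulate _ i) (dec-true (P? i) Pi))

  ∈-subset⁻ : (P? : Decidable P) → ∀ {i} → i ∈ subset P? → P i
  ∈-subset⁻ P? {i} i∈ with P? i | trans (sym (lookup∘tabulate (does ∘ P?) i)) ([]=⇒lookup i∈)
  ... | yes Pi | _  = Pi
  ... | no  _  | ()

  ∣subset∣≡∑𝟙 : (P? : Decidable P) → ∣ subset P? ∣ ≡ ∑[ i < n ] 𝟙 (does (P? i))
  ∣subset∣≡∑𝟙 P? =
    trans (∣p∣≡∑𝟙 (subset P?)) (sum-cong-≗ (cong 𝟙 ∘ lookup∘tabulate (does ∘ P?)))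

level : ∀ {n} → (Fin n → ℕ) → ℕ → Subset n
level h y = subset (λ v → h v ≟ y)

LevelBounded : ∀ {n} → (Fin n → ℕ) → Subset n → ℕ → Set
LevelBounded h S b = ∀ y → ∣ S ∩ level h y ∣ ≤ b

LevelBounded-+ : ∀ {n} {h : Fin n → ℕ} {S b} →
                 LevelBounded h S b → ∀ t → LevelBounded (λ v → h v + t) S b
LevelBounded-+ {h = h} {S} bounded t y = ≤-trans (p⊆q⇒∣p∣≤∣q∣ shifted⊆) (bounded (y ∸ t))
  where
  shifted⊆ : S ∩ level (λ v → h v + t) y ⊆ S ∩ level h (y ∸ t)
  shifted⊆ {v} v∈ with x∈p∩q⁻ S (level (λ w → h w + t) y) v∈
  ... | v∈S , v∈level = x∈p∩q⁺ (v∈S , ∈-subset⁺ (λ w → h w ≟ y ∸ t) hv≡y∸t)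
    where
    hv≡y∸t : h v ≡ y ∸ t
    hv≡y∸t = trans (sym (m+n∸n≡m (h v) t))
                   (cong (_∸ t) (∈-subset⁻ (λ w → h w + t ≟ y) v∈level))

∣window∣≤width*b : ∀ {n} {h : Fin n → ℕ} {S b} → LevelBounded h S b →
                   ∀ a r (C : Subset n) → C ⊆ S → (∀ {v} → v ∈ C → a ≤ h v × h v < a + r) →
                   ∣ C ∣ ≤ r * b
∣window∣≤width*b {n} {h} {S} {b} bounded a r C C⊆S inWindow = begin
  ∣ C ∣                                        ≡⟨ ∣p∣≡∑𝟙 C ⟩
  ∑[ v < n ] 𝟙 (lookup C v)                    ≤⟨ sum-mono-≤ covered ⟩
  ∑[ v < n ] ∑[ s < r ] 𝟙 (lookup (slice s) v) ≡⟨ ∑-comm (λ v s → 𝟙 (lookup (slice s) v)) ⟩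
  ∑[ s < r ] ∑[ v < n ] 𝟙 (lookup (slice s) v) ≡⟨ sum-cong-≗ (sym ∘ ∣p∣≡∑𝟙 ∘ slice) ⟩
  ∑[ s < r ] ∣ slice s ∣                       ≤⟨ sum-mono-≤ {r} (bounded ∘ (a +_) ∘ toℕ) ⟩
  ∑[ s < r ] b                                 ≡⟨ ∑-const r b ⟩
  r * b                                        ∎
  where
  open ≤-Reasoning
  slice : Fin r → Subset n
  slice s = S ∩ level h (a + toℕ s)

  covered : ∀ v → 𝟙 (lookup C v) ≤ ∑[ s < r ] 𝟙 (lookup (slice s) v)
  covered v with lookup C v in lookup≡true
  ... | false = z≤n
  ... | true  = ≤-trans (≤-reflexive (cong 𝟙 (sym ([]=⇒lookup v∈slice)))) (≤-sum _ s)
    where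
    v∈C : v ∈ C
    v∈C = lookup⇒[]= v C lookup≡true
    a≤hv : a ≤ h v
    a≤hv = proj₁ (inWindow v∈C)
    offset<r : h v ∸ a < r
    offset<r = subst (h v ∸ a <_) (m+n∸m≡n a r) (∸-monoˡ-< (proj₂ (inWindow v∈C)) a≤hv)
    s : Fin r
    s = Fin.fromℕ< offset<r
    hv≡a+s : h v ≡ a + toℕ s
    hv≡a+s = sym (trans (cong (a +_) (toℕ-fromℕ< offset<r)) (m+[n∸m]≡n a≤hv))
    v∈slice : v ∈ slice s
    v∈slice = x∈p∩q⁺ (C⊆S v∈C , ∈-subset⁺ (λ w → h w ≟ a + toℕ s) hv≡a+s)

EdgeLipschitz : ∀ {n} → Graph n → (Fin n → ℕ) → Set
EdgeLipschitz G h = ∀ {v w} → Adj G v w → h w ≤ suc (h v) × h v ≤ suc (h w)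

EdgeLipschitz-+ : ∀ {n} {G : Graph n} {h} →
                  EdgeLipschitz G h → ∀ t → EdgeLipschitz G (λ v → h v + t)
EdgeLipschitz-+ lipschitz t vw =
  +-monoˡ-≤ t (proj₁ (lipschitz vw)) , +-monoˡ-≤ t (proj₂ (lipschitz vw))

WithinComponent : ∀ {n} → Graph n → Subset n → Subset n → Set
WithinComponent G X C = ∀ u v → u ∈ C → v ∈ C → Reach G X u v

reach-source∉ : ∀ {n} {G : Graph n} {X u v} → Reach G X u v → u ∉ X
reach-source∉ (here u∉X)   = u∉X
reach-source∉ (step r _ _) = reach-source∉ r

cut : ∀ {n} → ℕ → (Fin n → ℕ) → Subset n
cut k h = subset (λ v → k ∣? h v)

∉cut⇒∤ : ∀ {n} k (h : Fin n → ℕ) {v} → v ∉ cut k h → k ∤ h v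
∉cut⇒∤ k h v∉cut = v∉cut ∘ ∈-subset⁺ (λ w → k ∣? h w)

StrictlyInBlock : ℕ → ℕ → ℕ → Set
StrictlyInBlock k q y = q * k < y × y < suc q * k

∤⇒strictlyInOwnBlock : ∀ {k y} .{{_ : NonZero k}} → k ∤ y → StrictlyInBlock k (y / k) y
∤⇒strictlyInOwnBlock {k} {y} k∤y =
  subst (y / k * k <_) (sym y≡r+qk) (m<n+m (y / k * k) (n≢0⇒n>0 (k∤y ∘ m%n≡0⇒n∣m y k))) ,
  subst (_< suc (y / k) * k) (sym y≡r+qk) (+-monoˡ-< (y / k * k) (m%n<n y k))
  where
  y≡r+qk : y ≡ y % k + y / k * k
  y≡r+qk = m≡m%n+[m/n]*n y k

strictlyInBlock-step : ∀ {k q y y′} → StrictlyInBlock k q y →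
                       y′ ≤ suc y → y ≤ suc y′ → k ∤ y′ → StrictlyInBlock k q y′
strictlyInBlock-step {k} {q} (qk<y , y<[1+q]k) y′≤1+y y≤1+y′ k∤y′ =
  ≤∧≢⇒< (≤-pred (≤-trans qk<y y≤1+y′)) (λ qk≡y′ → k∤y′ (subst (k ∣_) qk≡y′ (n∣m*n q))) ,
  ≤∧≢⇒< (≤-trans y′≤1+y y<[1+q]k)
        (λ y′≡[1+q]k → k∤y′ (subst (k ∣_) (sym y′≡[1+q]k) (n∣m*n (suc q))))

reach-preserves-block : ∀ {n} {G : Graph n} {h} → EdgeLipschitz G h → ∀ k q {u v} →
                        Reach G (cut k h) u v →
                        StrictlyInBlock k q (h u) → StrictlyInBlock k q (h v)
reach-preserves-block lipschitz k q (here _)          inBlock = inBlock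
reach-preserves-block {h = h} lipschitz k q (step r vw w∉cut) inBlock =
  strictlyInBlock-step {k} {q} (reach-preserves-block lipschitz k q r inBlock)
                       (proj₁ (lipschitz vw)) (proj₂ (lipschitz vw)) (∉cut⇒∤ k h w∉cut)

component-bound : ∀ {n} {G : Graph n} {h S b} → EdgeLipschitz G h → LevelBounded h S b →
                  ∀ k′ (C : Subset n) → C ⊆ S → WithinComponent G (cut (suc k′) h) C →
                  ∣ C ∣ ≤ k′ * b
component-bound {h = h} {b = b} lipschitz bounded k′ C C⊆S connected with nonempty? C
... | no  empty     = subst (_≤ k′ * b) (sym (Empty⇒∣p∣≡0 empty)) z≤n
... | yes (u , u∈C) = ∣window∣≤width*b bounded (suc (q * k)) k′ C C⊆S inWindow
  where
  k q : ℕ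
  k = suc k′
  q = h u / k
  uInBlock : StrictlyInBlock k q (h u)
  uInBlock = ∤⇒strictlyInOwnBlock (∉cut⇒∤ k h (reach-source∉ (connected u u u∈C u∈C)))
  inWindow : ∀ {v} → v ∈ C → suc (q * k) ≤ h v × h v < suc (q * k) + k′
  inWindow {v} v∈C with reach-preserves-block lipschitz k q (connected u v u∈C v∈C) uInBlock
  ... | qk<hv , hv<[1+q]k = qk<hv , subst (h v <_) (cong suc (+-comm k′ (q * k))) hv<[1+q]k

∣x+i⇒∤x+j : ∀ {k x i j} → i < j → j < k → k ∣ x + i → k ∤ x + j
∣x+i⇒∤x+j {k} {x} {i} {j} i<j j<k k∣x+i k∣x+j =
  >⇒∤ {{>-nonZero (m<n⇒0<n∸m i<j)}} (≤-<-trans (m∸n≤m j i) j<k)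
      (∣m+n∣m⇒∣n (subst (k ∣_) x+j≡x+i+[j∸i] k∣x+j) k∣x+i)
  where
  x+j≡x+i+[j∸i] : x + j ≡ x + i + (j ∸ i)
  x+j≡x+i+[j∸i] = trans (cong (x +_) (sym (m+[n∸m]≡n (<⇒≤ i<j)))) (sym (+-assoc x i (j ∸ i)))

∑-∣shifted-cut∣≤n : ∀ {n} (h : Fin n → ℕ) k → ∑[ t < k ] ∣ cut k (λ v → h v + toℕ t) ∣ ≤ n
∑-∣shifted-cut∣≤n {n} h k = begin
  ∑[ t < k ] ∣ cut k (λ v → h v + toℕ t) ∣     ≡⟨ sum-cong-≗ {k} (∣subset∣≡∑𝟙 ∘ divides) ⟩
  ∑[ t < k ] ∑[ v < n ] 𝟙 (does (divides t v)) ≡⟨ ∑-comm {k} {n} (λ t v → 𝟙 (does (divides t v))) ⟩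
  ∑[ v < n ] ∑[ t < k ] 𝟙 (does (divides t v)) ≤⟨ sum-mono-≤ {n} atMostOnceEach ⟩
  ∑[ v < n ] 1                                 ≡⟨ ∑-const n 1 ⟩
  n * 1                                        ≡⟨ *-identityʳ n ⟩
  n                                            ∎
  where
  open ≤-Reasoning
  divides : ∀ t v → Dec (k ∣ h v + toℕ t)
  divides t v = k ∣? h v + toℕ t
  atMostOne : ∀ v {s t : Fin k} → s Fin.< t → k ∣ h v + toℕ s → k ∤ h v + toℕ t
  atMostOne v {t = t} s<t = ∣x+i⇒∤x+j s<t (toℕ<n t)
  atMostOnceEach : ∀ v → ∑[ t < k ] 𝟙 (does (divides t v)) ≤ 1
  atMostOnceEach v = sum-𝟙-≤1 (λ t → divides t v) (atMostOne v)

separator : ∀ {n} {G : Graph n} {h S b} → EdgeLipschitz G h → LevelBounded h S b →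
            ∀ k′ → ∃ λ X → suc k′ * ∣ X ∣ ≤ n ×
            (∀ C → C ⊆ S → WithinComponent G X C → ∣ C ∣ ≤ k′ * b)
separator {n} {G} {h} {S} lipschitz bounded k′ =
  shiftedCut t ,
  ≤-trans k∣X∣≤∑ (∑-∣shifted-cut∣≤n h k) ,
  component-bound {h = λ v → h v + toℕ t}
                  (EdgeLipschitz-+ {G = G} lipschitz (toℕ t))
                  (LevelBounded-+ {h = h} {S} bounded (toℕ t)) k′
  where
  k : ℕ
  k = suc k′
  shiftedCut : Fin k → Subset n
  shiftedCut s = cut k (λ v → h v + toℕ s)
  t : Fin k
  t = proj₁ (∃-*≤sum (∣_∣ ∘ shiftedCut))
  k∣X∣≤∑ : k * ∣ shiftedCut t ∣ ≤ ∑[ s < k ] ∣ shiftedCut s ∣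
  k∣X∣≤∑ = proj₂ (∃-*≤sum (∣_∣ ∘ shiftedCut))

module _ {n} {G : Graph n} (𝓛 : Layering G) where

  layer : Fin n → Fin (suc (m 𝓛))
  layer v = proj₁ (cover 𝓛 v)

  ∈-layer : ∀ v → v ∈ L 𝓛 (layer v)
  ∈-layer v = proj₂ (cover 𝓛 v)

  layer-unique : ∀ {i v} → v ∈ L 𝓛 i → layer v ≡ i
  layer-unique {i} {v} v∈Li with layer v Fin.≟ i
  ... | yes eq = eq
  ... | no neq =
    ⊥-elim (∉⊥ (subst (v ∈_) (disjoint 𝓛 (layer v) i neq) (x∈p∩q⁺ (∈-layer v , v∈Li))))

  depth : Fin n → ℕ
  depth = toℕ ∘ layer

  depth-lipschitz : EdgeLipschitz G depth
  depth-lipschitz {v} {w} vw with nbhd 𝓛 (layer v) v w (∈-layer v) vw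
  ... | j , w∈Lj , j≤1+i , i≤1+j rewrite layer-unique w∈Lj = j≤1+i , i≤1+j

  depth-levelBounded : ∀ {S b} → (∀ i → ∣ L 𝓛 i ∩ S ∣ ≤ b) → LevelBounded depth S b
  depth-levelBounded {S} {b} layerBound y with nonempty? (S ∩ level depth y)
  ... | no  empty    = subst (_≤ b) (sym (Empty⇒∣p∣≡0 empty)) z≤n
  ... | yes (u , u∈) = ≤-trans (p⊆q⇒∣p∣≤∣q∣ level⊆layer) (layerBound (layer u))
    where
    depth≡y : ∀ {v} → v ∈ S ∩ level depth y → depth v ≡ y
    depth≡y v∈ = ∈-subset⁻ (λ w → depth w ≟ y) (proj₂ (x∈p∩q⁻ S (level depth y) v∈))
    level⊆layer : S ∩ level depth y ⊆ L 𝓛 (layer u) ∩ S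
    level⊆layer {v} v∈ =
      x∈p∩q⁺ (subst (λ i → v ∈ L 𝓛 i) (toℕ-injective (trans (depth≡y v∈) (sym (depth≡y u∈))))
                    (∈-layer v) ,
              proj₁ (x∈p∩q⁻ S (level depth y) v∈))

block-length : ∀ b n p q .{{_ : NonZero q}} →
               ∃ λ k′ → k′ * b * q ≤ p × (∀ x → suc k′ * x ≤ n → x * p ≤ b * n * q)
block-length zero n p q = n , subst (_≤ p) (sym (cong (_* q) (*-zeroʳ n))) z≤n , onlyZero
  where
  onlyZero : ∀ x → suc n * x ≤ n → x * p ≤ 0
  onlyZero zero    _        = z≤n
  onlyZero (suc x) [1+n]x≤n = ⊥-elim (1+n≰n (≤-trans (m≤m*n (suc n) (suc x)) [1+n]x≤n))
block-length b@(suc _) n p q = k′ , k′bq≤p , small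
  where
  B : ℕ
  B = b * q
  instance
    B≢0 : NonZero B
    B≢0 = m*n≢0 b q
  k′ : ℕ
  k′ = p / B
  k′bq≤p : k′ * b * q ≤ p
  k′bq≤p = subst (_≤ p) (sym (*-assoc k′ b q)) (m/n*n≤m p B)
  p<[1+k′]B : p < suc k′ * B
  p<[1+k′]B = subst (_< suc k′ * B) (sym (m≡m%n+[m/n]*n p B)) (+-monoˡ-< (k′ * B) (m%n<n p B))
  small : ∀ x → suc k′ * x ≤ n → x * p ≤ b * n * q
  small x [1+k′]x≤n = begin
    x * p            ≤⟨ *-monoʳ-≤ x (<⇒≤ p<[1+k′]B) ⟩
    x * (suc k′ * B) ≡⟨ sym (*-assoc x (suc k′) B) ⟩
    x * suc k′ * B   ≡⟨ cong (_* B) (*-comm x (suc k′)) ⟩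
    suc k′ * x * B   ≤⟨ *-monoˡ-≤ B [1+k′]x≤n ⟩
    n * (b * q)      ≡⟨ sym (*-assoc n b q) ⟩
    n * b * q        ≡⟨ cong (_* q) (*-comm n b) ⟩
    b * n * q        ∎
    where open ≤-Reasoning

mkℚᵘ-≤ : ∀ {a b c d} → a * suc d ≤ c * suc b → ℚᵘ.mkℚᵘ (ℤ.+ a) b ℚᵘ.≤ ℚᵘ.mkℚᵘ (ℤ.+ c) d
mkℚᵘ-≤ {a} {b} {c} {d} ad≤cb =
  ℚᵘ.*≤* (subst₂ ℤ._≤_ (ℤ.pos-* a (suc d)) (ℤ.pos-* c (suc b)) (ℤ.+≤+ ad≤cb))

toℚᵘ-ℕtoℚ : ∀ a → ℚ.toℚᵘ (ℕtoℚ a) ℚᵘ.≃ ℚᵘ.mkℚᵘ (ℤ.+ a) 0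
toℚᵘ-ℕtoℚ a = toℚᵘ-fromℚᵘ (ℚᵘ.mkℚᵘ (ℤ.+ a) 0)

ℕtoℚ-≤ : ∀ a {p q′} .{c : Coprime p (suc q′)} → a * suc q′ ≤ p → ℕtoℚ a ℚ.≤ ℚ.mkℚ (ℤ.+ p) q′ c
ℕtoℚ-≤ a {p} {q′} a[1+q′]≤p = toℚᵘ-cancel-≤ (begin
  ℚ.toℚᵘ (ℕtoℚ a)    ≃⟨ toℚᵘ-ℕtoℚ a ⟩
  ℚᵘ.mkℚᵘ (ℤ.+ a) 0  ≤⟨ mkℚᵘ-≤ (subst (a * suc q′ ≤_) (sym (*-identityʳ p)) a[1+q′]≤p) ⟩
  ℚᵘ.mkℚᵘ (ℤ.+ p) q′ ∎)
  where open ℚᵘ.≤-Reasoning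

ℕtoℚ-≤-÷ : ∀ x B {p q′} .{c : Coprime (suc p) (suc q′)} → x * suc p ≤ B * suc q′ →
           ℕtoℚ x ℚ.≤ ℕtoℚ B ℚ.÷ ℚ.mkℚ (ℤ.+ suc p) q′ c
ℕtoℚ-≤-÷ x B {p} {q′} {c} x[1+p]≤B[1+q′] = toℚᵘ-cancel-≤ (begin
  ℚ.toℚᵘ (ℕtoℚ x)                        ≃⟨ toℚᵘ-ℕtoℚ x ⟩
  ℚᵘ.mkℚᵘ (ℤ.+ x) 0                      ≤⟨ mkℚᵘ-≤ x[1+p]≤B[1+q′]*1 ⟩
  ℚᵘ.mkℚᵘ (ℤ.+ (B * suc q′)) p           ≡⟨ cong₂ ℚᵘ.mkℚᵘ (ℤ.pos-* B (suc q′)) (sym (+-identityʳ p)) ⟩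
  ℚᵘ.mkℚᵘ (ℤ.+ B) 0 ℚᵘ.* ℚ.toℚᵘ (ℚ.1/ d) ≃⟨ ℚᵘ.*-congʳ (toℚᵘ-ℕtoℚ B) ⟨
  ℚ.toℚᵘ (ℕtoℚ B) ℚᵘ.* ℚ.toℚᵘ (ℚ.1/ d)   ≃⟨ toℚᵘ-homo-* (ℕtoℚ B) (ℚ.1/ d) ⟨
  ℚ.toℚᵘ (ℕtoℚ B ℚ.÷ d)                  ∎)
  where
  open ℚᵘ.≤-Reasoning
  d : ℚ
  d = ℚ.mkℚ (ℤ.+ suc p) q′ c
  x[1+p]≤B[1+q′]*1 : x * suc p ≤ B * suc q′ * 1
  x[1+p]≤B[1+q′]*1 = subst (x * suc p ≤_) (sym (*-identityʳ (B * suc q′))) x[1+p]≤B[1+q′]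

mainTheorem17 : (b n : ℕ) (G : Graph n) (𝓛 : Layering G) (S : Subset n) →
    (∀ i → ∣ L 𝓛 i ∩ S ∣ Data.Nat.≤ b) →
    (d : ℚ) → .{{_ : Positive d}} →
    Σ (Subset n) λ X →
      (ℕtoℚ ∣ X ∣ ℚ.≤ ℚ._÷_ (ℕtoℚ (b * n)) d {{pos⇒nonZero d}}) ×
      ((C : Subset n) → C ⊆ S → (∀ u v → u ∈ C → v ∈ C → Reach G X u v) →
        ℕtoℚ ∣ C ∣ ℚ.≤ d)
mainTheorem17 b n G 𝓛 S layerBound (ℚ.mkℚ (ℤ.+ suc p) q′ c) =
  let (k′ , k′bq≤p , small) = block-length b n (suc p) (suc q′)
      (X , k∣X∣≤n , components) =
        separator (depth-lipschitz 𝓛) (depth-levelBounded 𝓛 layerBound) k′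
  in X ,
     ℕtoℚ-≤-÷ ∣ X ∣ (b * n) {c = c} (small ∣ X ∣ k∣X∣≤n) ,
     λ C C⊆S connected →
       ℕtoℚ-≤ ∣ C ∣ (≤-trans (*-monoˡ-≤ (suc q′) (components C C⊆S connected)) k′bq≤p)
mainTheorem17 b n G 𝓛 S layerBound (ℚ.mkℚ (ℤ.+ zero) q′ c) {{d>0}} = ⊥-elim-irr (ℤ.Positive.pos d>0)
mainTheorem17 b n G 𝓛 S layerBound (ℚ.mkℚ ℤ.-[1+ _ ] q′ c) {{d>0}} = ⊥-elim-irr (ℤ.Positive.pos d>0)
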